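{- Let $\alpha\in PP_n$ and $k\ge1$, and assume all cars follow the $k$-Naples parking rule. Then $\alpha\in PF_{n,k}$ if and only if for every maximal interval $[p,q]\subseteq U_\alpha$, spot $p-1$ is occupied at the end of the process. In particular, if $\alpha\in PF_{n,k}$ then for every maximal interval $[p,q]\subseteq U_\alpha$ there exists $i\in[n]$ with $a_i\ge p$ and $\psi_k(c_i)=p-1$.
   Context: $[n]=\{1,\dots,n\}$, $PP_n=[n]^n$; $[a,b]$ is the integer interval. Cars $c_1,\dots,c_n$ arrive in order at a one-way street with spots $1,\dots,n$; car $c_i$ has preference $a_i$. Under the $k$-Naples parking rule, car $c_i$ drives to spot $a_i$ and parks there if free; otherwise it checks spots $a_i-1,\dots,a_i-k$ (only those $\ge1$) in order and parks in the first free one; otherwise it drives forward to the first free spot $j>a_i$, failing if none. $PF_{n,k}$: preferences for which all cars park. $\psi_k(c_i)$ is the spot where $c_i$ parks (or $\infty$). $|\alpha|_i=|\{j:a_j=i\}|$, $u_\alpha(j)=\sum_{i=j}^n|\alpha|_i-(n-j+1)$, $U_\alpha=\{j\in[n]:u_\alpha(j)\ge1\}$ (note $1\notin U_\alpha$). A maximal interval of a finite set $A\subseteq\mathbb N$ is an interval $I\subseteq A$ not strictly contained in any other interval contained in $A$. -}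

module Defs where

open import Data.Nat using (ℕ; zero; suc; _+_; _∸_; _≤_; _≟_)
open import Data.Nat.Properties using ()
open import Data.Integer as ℤ using (ℤ; +_)
open import Data.Maybe using (Maybe; just; nothing; Is-just)
open import Data.List using (List; []; _∷_; filter; length)
open import Data.Fin using (Fin)
open import Data.List.Membership.DecPropositional _≟_ using (_∈?_)
open import Data.Vec as V using (Vec; []; _∷_; toList)
open import Data.Vec.Relation.Unary.All as VAll using ()
open import Data.Product using (_×_)
open import Relation.Binary.PropositionalEquality using (_≡_)
open import Relation.Nullary using (yes; no)

-- Spots and preferences are 1-based natural numbers.

InPP : (n : ℕ) → Vec ℕ n → Set
InPP n α = VAll.All (λ a → 1 ≤ a × a ≤ n) α

checkBack : ℕ → ℕ → List ℕ → Maybe ℕ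
checkBack zero    m       occ = nothing
checkBack (suc s) zero    occ = nothing
checkBack (suc s) (suc m) occ with suc s ∈? occ
... | yes _ = checkBack s m occ
... | no  _ = just (suc s)

checkFwd : ℕ → ℕ → List ℕ → Maybe ℕ
checkFwd s zero    occ = nothing
checkFwd s (suc m) occ with s ∈? occ
... | yes _ = checkFwd (suc s) m occ
... | no  _ = just s

-- Where a car with preference a parks under the k-Naples rule,
-- given the list occ of occupied spots (nothing = fails to park, i.e. ∞).
parkSpot : (n k : ℕ) → List ℕ → ℕ → Maybe ℕ
parkSpot n k occ a with a ∈? occ
... | no  _ = just a
... | yes _ with checkBack (a ∸ 1) k occ
...   | just s  = just s
...   | nothing = checkFwd (suc a) (n ∸ a) occ

addSpot : Maybe ℕ → List ℕ → List ℕ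
addSpot nothing  occ = occ
addSpot (just s) occ = s ∷ occ

runFrom : (n k : ℕ) → {m : ℕ} → List ℕ → Vec ℕ m → Vec (Maybe ℕ) m × List ℕ
runFrom n k occ [] = [] Data.Product., occ
runFrom n k occ (a ∷ as) with parkSpot n k occ a
... | r with runFrom n k (addSpot r occ) as
...   | rs Data.Product., fin = (r ∷ rs) Data.Product., fin

-- ψ_k(c_i): spot where car i parks (nothing represents ∞).
ψ : (n k : ℕ) → Vec ℕ n → Fin n → Maybe ℕ
ψ n k α i = V.lookup (Data.Product.proj₁ (runFrom n k [] α)) i

finalOccupied : (n k : ℕ) → Vec ℕ n → List ℕ
finalOccupied n k α = Data.Product.proj₂ (runFrom n k [] α)

PF : (n k : ℕ) → Vec ℕ n → Set
PF n k α = ∀ i → Is-just (ψ n k α i)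

mult : {n : ℕ} → Vec ℕ n → ℕ → ℕ
mult α i = length (filter (_≟ i) (toList α))

sumFrom : {n : ℕ} → Vec ℕ n → ℕ → ℕ
sumFrom {n} α j = go (suc n ∸ j) j
  where
  go : ℕ → ℕ → ℕ
  go zero    i = 0
  go (suc r) i = mult α i + go r (suc i)

u : {n : ℕ} → Vec ℕ n → ℕ → ℤ
u {n} α j = (+ sumFrom α j) ℤ.- (+ (n + 1 ∸ j))

InU : {n : ℕ} → Vec ℕ n → ℕ → Set
InU {n} α j = (1 ≤ j × j ≤ n) × (+ 1 ℤ.≤ u α j)

IntervalIn : (ℕ → Set) → ℕ → ℕ → Set
IntervalIn A p q = p ≤ q × (∀ j → p ≤ j → j ≤ q → A j)

MaximalInterval : (ℕ → Set) → ℕ → ℕ → Set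
MaximalInterval A p q =
  IntervalIn A p q ×
  (∀ p' q' → IntervalIn A p' q' → p' ≤ p → q ≤ q' → p' ≡ p × q' ≡ q)

-- Write T(j) for the number of cars preferring a spot ≥ j.  For j ≥ 1, j ∈ U_α iff
-- T(j) > n − j + 1, so s ≥ 1 is the spot just left of a maximal interval of U_α iff
-- T(s+1) = n − s + 1 and no car prefers s.
--
-- If every car parks, take such an s and suppose no car preferring a spot beyond s parks at s.
-- As nobody prefers s, it can then only be taken by a car from the left whose backward search
-- failed, and then the k − 1 spots below s are taken too; so no car from the right ever gets
-- past s.  Hence the T(s+1) = n − s + 1 cars preferring spots beyond s all park among the
-- n − s spots beyond s, which is impossible.
--
-- If some car fails, let f be the first empty spot.  Cars preferring a spot ≤ f park at or
-- below f, cars preferring a spot > f park beyond f or fail, and nobody prefers f.  Counting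
-- the f − 1 occupied spots below f gives T(f+1) = n − f + 1, so f is the spot just left of a
-- maximal interval of U_α, yet it stays empty.

module Submission where

open import Defs
open import Data.Nat using (ℕ; _≤_; _∸_)
open import Data.Fin using (Fin)
open import Data.Vec using (Vec; lookup)
open import Data.Maybe using (just)
open import Data.List.Membership.Propositional using (_∈_)
open import Data.Product using (_×_; ∃-syntax)
open import Function.Bundles using (_⇔_)
open import Relation.Binary.PropositionalEquality using (_≡_)

open import Level using (0ℓ)
open import Data.Nat
open import Data.Nat.Properties
import Data.Integer as ℤ
import Data.Integer.Properties as ℤ
open import Data.Vec using ([]; _∷_; count; countᵇ; iterate)
open import Data.Vec.Properties using (count≤n)
open import Data.Vec.Relation.Unary.All as All using (All; []; _∷_)
open import Data.Product
import Data.Fin as Fin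
open import Data.Fin.Properties using (any?)
open import Data.Maybe using (Maybe; nothing; Is-just; is-nothing)
open import Data.Maybe.Properties using (just-injective) renaming (≡-dec to ≡-dec-Maybe)
open import Data.Maybe.Relation.Unary.Any using (just)
open import Data.Unit using (tt)
open import Data.List using (List; []; _∷_)
open import Data.List.Relation.Unary.Any using (here; there)
open import Data.List.Membership.Propositional using (_∉_)
open import Data.List.Membership.DecPropositional _≟_ using (_∈?_)
open import Data.List.Relation.Binary.Subset.Propositional using (_⊆_)
open import Data.Empty using (⊥-elim)
open import Data.Sum using (inj₁; inj₂)
open import Function.Base using (_∘_)
open import Function.Bundles using (mk⇔; Equivalence)
open import Relation.Nullary
open import Relation.Nullary.Decidable using (dec-true; dec-false; _×-dec_)
open import Relation.Unary using (Pred; Decidable)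
open import Relation.Binary using (tri<; tri≈; tri>)
open import Relation.Binary.PropositionalEquality

open Equivalence using (to; from)

private variable
  n m : ℕ

-- Preference counts and the set U_α

module _ {P : Pred ℕ 0ℓ} (P? : Decidable P) where

  count-yes : ∀ {x} (xs : Vec ℕ m) → P x → count P? (x ∷ xs) ≡ suc (count P? xs)
  count-yes {x = x} xs p rewrite dec-true (P? x) p = refl

  count-no : ∀ {x} (xs : Vec ℕ m) → ¬ P x → count P? (x ∷ xs) ≡ count P? xs
  count-no {x = x} xs ¬p rewrite dec-false (P? x) ¬p = refl

  count≡0⇒All¬ : (xs : Vec ℕ m) → count P? xs ≡ 0 → All (λ x → ¬ P x) xs
  count≡0⇒All¬ []       _  = []
  count≡0⇒All¬ (x ∷ xs) eq with P? x
  ... | no ¬p = ¬p ∷ count≡0⇒All¬ xs eq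

  All¬⇒count≡0 : {xs : Vec ℕ m} → All (λ x → ¬ P x) xs → count P? xs ≡ 0
  All¬⇒count≡0 []                  = refl
  All¬⇒count≡0 {xs = x ∷ _} (¬p ∷ ¬ps) with P? x
  ... | yes p = ⊥-elim (¬p p)
  ... | no _  = All¬⇒count≡0 ¬ps

  All⇒count≡n : {xs : Vec ℕ m} → All P xs → count P? xs ≡ m
  All⇒count≡n []                 = refl
  All⇒count≡n {xs = x ∷ _} (p ∷ ps) with P? x
  ... | yes _ = cong suc (All⇒count≡n ps)
  ... | no ¬p = ⊥-elim (¬p p)

tailMult : Vec ℕ n → ℕ → ℕ
tailMult α j = count (j ≤?_) α

mult≡count : (α : Vec ℕ n) (j : ℕ) → mult α j ≡ count (_≟ j) α
mult≡count []      j = refl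
mult≡count (a ∷ α) j with a ≟ j
... | yes a≡j rewrite dec-true (a ≟ j) a≡j = cong suc (mult≡count α j)
... | no  a≢j rewrite dec-false (a ≟ j) a≢j = mult≡count α j

tailMult-step : (α : Vec ℕ n) (j : ℕ) → tailMult α j ≡ count (_≟ j) α + tailMult α (suc j)
tailMult-step []      j = refl
tailMult-step (a ∷ α) j with <-cmp a j
... | tri< a<j a≢j _ = begin
  count (j ≤?_) (a ∷ α)
    ≡⟨ count-no (j ≤?_) α (<⇒≱ a<j) ⟩
  count (j ≤?_) α
    ≡⟨ tailMult-step α j ⟩
  count (_≟ j) α + count (suc j ≤?_) α
    ≡⟨ cong₂ _+_ (count-no (_≟ j) α a≢j) (count-no (suc j ≤?_) α (<⇒≱ (m<n⇒m<1+n a<j))) ⟨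
  count (_≟ j) (a ∷ α) + count (suc j ≤?_) (a ∷ α)  ∎
  where open ≡-Reasoning
... | tri≈ _ refl _ = begin
  count (a ≤?_) (a ∷ α)
    ≡⟨ count-yes (a ≤?_) α ≤-refl ⟩
  suc (count (a ≤?_) α)
    ≡⟨ cong suc (tailMult-step α a) ⟩
  suc (count (_≟ a) α + count (suc a ≤?_) α)
    ≡⟨ cong₂ _+_ (count-yes (_≟ a) α refl) (count-no (suc a ≤?_) α (<-irrefl refl)) ⟨
  count (_≟ a) (a ∷ α) + count (suc a ≤?_) (a ∷ α)  ∎
  where open ≡-Reasoning
... | tri> _ a≢j j<a = begin
  count (j ≤?_) (a ∷ α)
    ≡⟨ count-yes (j ≤?_) α (<⇒≤ j<a) ⟩
  suc (count (j ≤?_) α)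
    ≡⟨ cong suc (tailMult-step α j) ⟩
  suc (count (_≟ j) α + count (suc j ≤?_) α)
    ≡⟨ +-suc _ _ ⟨
  count (_≟ j) α + suc (count (suc j ≤?_) α)
    ≡⟨ cong₂ _+_ (count-no (_≟ j) α a≢j) (count-yes (suc j ≤?_) α j<a) ⟨
  count (_≟ j) (a ∷ α) + count (suc j ≤?_) (a ∷ α)  ∎
  where open ≡-Reasoning

tailMult-beyond : {α : Vec ℕ n} → All (_≤ n) α → ∀ {j} → n < j → tailMult α j ≡ 0
tailMult-beyond α≤n n<j =
  All¬⇒count≡0 (_ ≤?_) (All.map (λ a≤n j≤a → <⇒≱ n<j (≤-trans j≤a a≤n)) α≤n)

sumFrom-step : (α : Vec ℕ n) (j : ℕ) → j ≤ n → sumFrom α j ≡ mult α j + sumFrom α (suc j)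
sumFrom-step {n} α j j≤n with suc n ∸ j | +-∸-assoc 1 j≤n
... | .(suc (n ∸ j)) | refl = refl

sumFrom≡tailMult : (α : Vec ℕ n) → All (_≤ n) α → ∀ j → j ≤ suc n → sumFrom α j ≡ tailMult α j
sumFrom≡tailMult {n} α α≤n j j≤1+n = go (suc n ∸ j) j (m∸n+n≡m j≤1+n)
  where
  go : ∀ d j → d + j ≡ suc n → sumFrom α j ≡ tailMult α j
  go zero    .(suc n) refl rewrite n∸n≡0 n = sym (tailMult-beyond α≤n ≤-refl)
  go (suc d) j d+j≡ = begin
    sumFrom α j                         ≡⟨ sumFrom-step α j (≤-pred (m+n≤o⇒n≤o d (≤-reflexive d+1+j≡))) ⟩
    mult α j + sumFrom α (suc j)        ≡⟨ cong₂ _+_ (mult≡count α j) (go d (suc j) d+1+j≡) ⟩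
    count (_≟ j) α + tailMult α (suc j) ≡⟨ tailMult-step α j ⟨
    tailMult α j                        ∎
    where
    open ≡-Reasoning
    d+1+j≡ : d + suc j ≡ suc n
    d+1+j≡ = trans (+-suc d j) d+j≡

+1≤m-n⇔n<m : ∀ m n → (ℤ.+ 1 ℤ.≤ ℤ.+ m ℤ.- ℤ.+ n) ⇔ n < m
+1≤m-n⇔n<m m n rewrite ℤ.[+m]-[+n]≡m⊖n m n = mk⇔ to′ from′
  where
  to′ : ℤ.+ 1 ℤ.≤ m ℤ.⊖ n → n < m
  to′ 1≤m⊖n with n <? m
  ... | yes n<m = n<m
  ... | no  n≮m = ⊥-elim (ℤ.<⇒≱ (ℤ.+<+ (s≤s z≤n)) 1≤0)
    where
    1≤0 : ℤ.+ 1 ℤ.≤ ℤ.+ 0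
    1≤0 = ℤ.≤-trans 1≤m⊖n
            (ℤ.≤-trans (ℤ.⊖-monoʳ-≥-≤ m (≮⇒≥ n≮m)) (ℤ.≤-reflexive (ℤ.n⊖n≡0 m)))
  from′ : n < m → ℤ.+ 1 ℤ.≤ m ℤ.⊖ n
  from′ n<m rewrite ℤ.⊖-≥ (<⇒≤ n<m) = ℤ.+≤+ (m<n⇒0<n∸m n<m)

InU? : (α : Vec ℕ n) → Decidable (InU α)
InU? {n} α j = ((1 ≤? j) ×-dec (j ≤? n)) ×-dec (ℤ.+ 1 ℤ.≤? u α j)

InU-suc⇔ : {α : Vec ℕ n} → InPP n α → ∀ s → InU α (suc s) ⇔ (s < n × n ∸ s < tailMult α (suc s))
InU-suc⇔ {n} {α} pp s = mk⇔
  (λ { ((_ , s<n) , 1≤u) →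
         s<n , subst₂ _<_ n+1∸1+s≡n∸s (sums≡ s<n) (to (+1≤m-n⇔n<m _ _) 1≤u) })
  (λ { (s<n , n∸s<T) →
         (s≤s z≤n , s<n) , from (+1≤m-n⇔n<m _ _) (subst₂ _<_ (sym n+1∸1+s≡n∸s) (sym (sums≡ s<n)) n∸s<T) })
  where
  n+1∸1+s≡n∸s : n + 1 ∸ suc s ≡ n ∸ s
  n+1∸1+s≡n∸s = cong (_∸ suc s) (+-comm n 1)
  sums≡ : s < n → sumFrom α (suc s) ≡ tailMult α (suc s)
  sums≡ s<n = sumFrom≡tailMult α (All.map proj₂ pp) (suc s) (m≤n⇒m≤1+n s<n)

¬InU-1 : {α : Vec ℕ n} → InPP n α → ¬ InU α 1
¬InU-1 pp U1 = <-irrefl (sym (All⇒count≡n (1 ≤?_) (All.map proj₁ pp))) (proj₂ (to (InU-suc⇔ pp 0) U1))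

leftEnd⇔ : {α : Vec ℕ n} → InPP n α → ∀ s → 1 ≤ s →
  (InU α (suc s) × ¬ InU α s) ⇔ (tailMult α (suc s) ≡ suc (n ∸ s) × count (_≟ s) α ≡ 0)
leftEnd⇔ {n} {α} pp s@(suc r) _ = mk⇔ to′ from′
  where
  T c : ℕ
  T = tailMult α (suc s)
  c = count (_≟ s) α
  n∸r≡ : s ≤ n → n ∸ r ≡ suc (n ∸ s)
  n∸r≡ s≤n = +-∸-assoc 1 s≤n
  to′ : InU α (suc s) × ¬ InU α s → T ≡ suc (n ∸ s) × c ≡ 0
  to′ (Us , ¬Ur) = ≤-antisym T≤ n∸s<T , n≤0⇒n≡0 (+-cancelʳ-≤ T c 0 (≤-trans c+T≤ n∸s<T))
    where
    s<n : s < n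
    s<n = proj₁ (to (InU-suc⇔ pp s) Us)
    n∸s<T : n ∸ s < T
    n∸s<T = proj₂ (to (InU-suc⇔ pp s) Us)
    c+T≤ : c + T ≤ suc (n ∸ s)
    c+T≤ = subst₂ _≤_ (tailMult-step α s) (n∸r≡ (<⇒≤ s<n))
             (≮⇒≥ (λ lt → ¬Ur (from (InU-suc⇔ pp r) (<⇒≤ s<n , lt))))
    T≤ : T ≤ suc (n ∸ s)
    T≤ = ≤-trans (m≤n+m T c) c+T≤
  from′ : T ≡ suc (n ∸ s) × c ≡ 0 → InU α (suc s) × ¬ InU α s
  from′ (T≡ , c≡0) = from (InU-suc⇔ pp s) (s<n , n∸s<T) , ¬Ur
    where
    n∸s<T : n ∸ s < T
    n∸s<T = ≤-reflexive (sym T≡)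
    s<n : s < n
    s<n = ≰⇒> (λ n≤s → 1+n≢0 (trans (sym T≡) (tailMult-beyond (All.map proj₂ pp) (s≤s n≤s))))
    ¬Ur : ¬ InU α s
    ¬Ur Ur = <-irrefl (trans (n∸r≡ (<⇒≤ s<n)) (sym (trans (tailMult-step α s) (cong₂ _+_ c≡0 T≡))))
                      (proj₂ (to (InU-suc⇔ pp r) Ur))

-- Maximal intervals

module _ {A : ℕ → Set} where

  MaximalInterval⇒lower : ∀ {p q} → MaximalInterval A p q → A p
  MaximalInterval⇒lower ((p≤q , inA) , _) = inA _ ≤-refl p≤q

  MaximalInterval⇒¬pred : ∀ {s q} → MaximalInterval A (suc s) q → ¬ A s
  MaximalInterval⇒¬pred {s} ((1+s≤q , inA) , maximal) As =
    1+n≢n (sym (proj₁ (maximal s _ (≤-trans (n≤1+n s) 1+s≤q , inA′) (n≤1+n s) ≤-refl)))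
    where
    inA′ : ∀ j → s ≤ j → j ≤ _ → A j
    inA′ j s≤j j≤q with m≤n⇒m<n∨m≡n s≤j
    ... | inj₁ s<j  = inA j s<j j≤q
    ... | inj₂ refl = As

  extendRight : Decidable A → ∀ r {p q} → (∀ j → A j → j ≤ q + r) →
                IntervalIn A p q → ∃[ q′ ] IntervalIn A p q′ × ¬ A (suc q′)
  extendRight A? r {q = q} bound I with A? (suc q)
  ... | no ¬A1+q = q , I , ¬A1+q
  extendRight A? zero    {q = q} bound I | yes A1+q =
    ⊥-elim (1+n≰n (subst (suc q ≤_) (+-identityʳ q) (bound _ A1+q)))
  extendRight A? (suc r) {q = q} bound (p≤q , inA) | yes A1+q =
    extendRight A? r (λ j Aj → subst (j ≤_) (+-suc q r) (bound j Aj)) (m≤n⇒m≤1+n p≤q , inA′)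
    where
    inA′ : ∀ j → _ ≤ j → j ≤ suc q → A j
    inA′ j p≤j j≤1+q with m≤n⇒m<n∨m≡n j≤1+q
    ... | inj₁ j<1+q = inA j p≤j (≤-pred j<1+q)
    ... | inj₂ refl  = A1+q

  maximalInterval-between : ∀ {f q} → IntervalIn A (suc f) q → ¬ A f → ¬ A (suc q) →
                            MaximalInterval A (suc f) q
  maximalInterval-between {f} {q} (1+f≤q , inA) ¬Af ¬A1+q = (1+f≤q , inA) , maximal
    where
    maximal : ∀ p′ q′ → IntervalIn A p′ q′ → p′ ≤ suc f → q ≤ q′ → p′ ≡ suc f × q′ ≡ q
    maximal p′ q′ (_ , inA′) p′≤1+f q≤q′ with m≤n⇒m<n∨m≡n p′≤1+f | m≤n⇒m<n∨m≡n q≤q′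
    ... | inj₁ p′<1+f | _ =
      ⊥-elim (¬Af (inA′ f (≤-pred p′<1+f) (≤-trans (n≤1+n f) (≤-trans 1+f≤q q≤q′))))
    ... | inj₂ _ | inj₁ q<q′ =
      ⊥-elim (¬A1+q (inA′ (suc q) (≤-trans p′≤1+f (≤-trans 1+f≤q (n≤1+n q))) q<q′))
    ... | inj₂ p′≡ | inj₂ q≡ = p′≡ , sym q≡

  maximalInterval-after : Decidable A → ∀ {n} → (∀ j → A j → j ≤ n) → ∀ {f} → ¬ A f → A (suc f) →
                          ∃[ q ] MaximalInterval A (suc f) q
  maximalInterval-after A? {n} bound {f} ¬Af A1+f =
    let q , I , ¬A1+q = extendRight A? n (λ j Aj → ≤-trans (bound j Aj) (m≤n+m n (suc f))) single
    in  q , maximalInterval-between I ¬Af ¬A1+q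
    where
    single : IntervalIn A (suc f) (suc f)
    single = ≤-refl , λ j 1+f≤j j≤1+f → subst A (≤-antisym 1+f≤j j≤1+f) A1+f

-- Occupied spots in an interval

#occupied : List ℕ → ℕ → ℕ → ℕ
#occupied occ j r = count (_∈? occ) (iterate suc j r)

#occupied-[] : ∀ j r → #occupied [] j r ≡ 0
#occupied-[] j r = All¬⇒count≡0 (_∈? []) (All.universal (λ _ ()) (iterate suc j r))

#occupied-yes : ∀ {occ j} r → j ∈ occ → #occupied occ j (suc r) ≡ suc (#occupied occ (suc j) r)
#occupied-yes {occ} {j} r = count-yes (_∈? occ) (iterate suc (suc j) r)

#occupied-no : ∀ {occ j} r → j ∉ occ → #occupied occ j (suc r) ≡ #occupied occ (suc j) r
#occupied-no {occ} {j} r = count-no (_∈? occ) (iterate suc (suc j) r)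

#occupied-full : ∀ occ j r → (∀ t → j ≤ t → t < j + r → t ∈ occ) → #occupied occ j r ≡ r
#occupied-full occ j zero    _    = refl
#occupied-full occ j (suc r) full with j ∈? occ
... | no j∉ = ⊥-elim (j∉ (full j ≤-refl (m<m+n j (s≤s z≤n))))
... | yes _ = cong suc (#occupied-full occ (suc j) r
                          (λ t j<t t<end → full t (<⇒≤ j<t) (subst (t <_) (sym (+-suc j r)) t<end)))

#occupied-split : ∀ occ j r₁ r₂ →
                  #occupied occ j (r₁ + r₂) ≡ #occupied occ j r₁ + #occupied occ (j + r₁) r₂
#occupied-split occ j zero     r₂ rewrite +-identityʳ j = refl
#occupied-split occ j (suc r₁) r₂ rewrite +-suc j r₁ with j ∈? occ
... | yes _ = cong suc (#occupied-split occ (suc j) r₁ r₂)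
... | no  _ = #occupied-split occ (suc j) r₁ r₂

∉-∷ : ∀ {x y : ℕ} {xs} → y ≢ x → y ∉ xs → y ∉ x ∷ xs
∉-∷ y≢x y∉ (here y≡x) = y≢x y≡x
∉-∷ y≢x y∉ (there y∈) = y∉ y∈

#occupied-∷-below : ∀ occ {x} j r → x < j → #occupied (x ∷ occ) j r ≡ #occupied occ j r
#occupied-∷-below occ j zero    _   = refl
#occupied-∷-below occ {x} j (suc r) x<j = byMembership (j ∈? occ)
  where
  open ≡-Reasoning
  byMembership : Dec (j ∈ occ) → #occupied (x ∷ occ) j (suc r) ≡ #occupied occ j (suc r)
  byMembership (yes j∈) = begin
    #occupied (_ ∷ occ) j (suc r)        ≡⟨ #occupied-yes r (there j∈) ⟩
    suc (#occupied (_ ∷ occ) (suc j) r)  ≡⟨ cong suc (#occupied-∷-below occ (suc j) r (m<n⇒m<1+n x<j)) ⟩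
    suc (#occupied occ (suc j) r)        ≡⟨ #occupied-yes r j∈ ⟨
    #occupied occ j (suc r)              ∎
  byMembership (no j∉) = begin
    #occupied (_ ∷ occ) j (suc r)        ≡⟨ #occupied-no r (∉-∷ (>⇒≢ x<j) j∉) ⟩
    #occupied (_ ∷ occ) (suc j) r        ≡⟨ #occupied-∷-below occ (suc j) r (m<n⇒m<1+n x<j) ⟩
    #occupied occ (suc j) r              ≡⟨ #occupied-no r j∉ ⟨
    #occupied occ j (suc r)              ∎

#occupied-∷-inside : ∀ occ {x} j r → x ∉ occ → j ≤ x → x < j + r →
                     #occupied (x ∷ occ) j r ≡ suc (#occupied occ j r)
#occupied-∷-inside occ j zero x∉ j≤x x<j+0 = ⊥-elim (<⇒≱ (subst (_ <_) (+-identityʳ j) x<j+0) j≤x)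
#occupied-∷-inside occ {x} j (suc r) x∉ j≤x x<end with m≤n⇒m<n∨m≡n j≤x
... | inj₂ refl = begin
  #occupied (j ∷ occ) j (suc r)        ≡⟨ #occupied-yes r (here refl) ⟩
  suc (#occupied (j ∷ occ) (suc j) r)  ≡⟨ cong suc (#occupied-∷-below occ (suc j) r ≤-refl) ⟩
  suc (#occupied occ (suc j) r)        ≡⟨ cong suc (#occupied-no r x∉) ⟨
  suc (#occupied occ j (suc r))        ∎
  where open ≡-Reasoning
... | inj₁ j<x = byMembership (j ∈? occ)
  where
  open ≡-Reasoning
  IH : #occupied (x ∷ occ) (suc j) r ≡ suc (#occupied occ (suc j) r)
  IH = #occupied-∷-inside occ (suc j) r x∉ j<x (subst (x <_) (+-suc j r) x<end)
  byMembership : Dec (j ∈ occ) → #occupied (x ∷ occ) j (suc r) ≡ suc (#occupied occ j (suc r))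
  byMembership (yes j∈) = begin
    #occupied (x ∷ occ) j (suc r)        ≡⟨ #occupied-yes r (there j∈) ⟩
    suc (#occupied (x ∷ occ) (suc j) r)  ≡⟨ cong suc IH ⟩
    suc (suc (#occupied occ (suc j) r))  ≡⟨ cong suc (#occupied-yes r j∈) ⟨
    suc (#occupied occ j (suc r))        ∎
  byMembership (no j∉) = begin
    #occupied (x ∷ occ) j (suc r)        ≡⟨ #occupied-no r (∉-∷ (<⇒≢ j<x) j∉) ⟩
    #occupied (x ∷ occ) (suc j) r        ≡⟨ IH ⟩
    suc (#occupied occ (suc j) r)        ≡⟨ cong suc (#occupied-no r j∉) ⟨
    suc (#occupied occ j (suc r))        ∎

#occupied-mono : ∀ {occ occ′} → occ ⊆ occ′ → ∀ j r → #occupied occ j r ≤ #occupied occ′ j r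
#occupied-mono sub j zero = z≤n
#occupied-mono {occ} {occ′} sub j (suc r) with j ∈? occ | j ∈? occ′
... | yes _  | yes _    = s≤s (#occupied-mono sub (suc j) r)
... | no _   | yes _    = m≤n⇒m≤1+n (#occupied-mono sub (suc j) r)
... | no _   | no _     = #occupied-mono sub (suc j) r
... | yes j∈ | no j∉′   = ⊥-elim (j∉′ (sub j∈))

firstFree : ∀ occ j r → #occupied occ j r < r →
            ∃[ f ] j ≤ f × f < j + r × f ∉ occ × (∀ t → j ≤ t → t < f → t ∈ occ)
firstFree occ j (suc r) lt with j ∈? occ
... | no j∉ = j , ≤-refl , m<m+n j (s≤s z≤n) , j∉ , λ t j≤t t<j → ⊥-elim (<⇒≱ t<j j≤t)
... | yes j∈ =
  let f , j<f , f<end , f∉ , below = firstFree occ (suc j) r (≤-pred lt)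
  in  f , <⇒≤ j<f , subst (f <_) (sym (+-suc j r)) f<end , f∉ , below′ below
  where
  below′ : ∀ {f} → (∀ t → suc j ≤ t → t < f → t ∈ occ) → ∀ t → j ≤ t → t < f → t ∈ occ
  below′ below t j≤t t<f with m≤n⇒m<n∨m≡n j≤t
  ... | inj₁ j<t  = below t j<t t<f
  ... | inj₂ refl = j∈

#occupied-after-firstFree : ∀ occ {f} r → 1 ≤ f → f ≤ r → f ∉ occ → (∀ t → 1 ≤ t → t < f → t ∈ occ) →
                            #occupied occ 1 r ≡ (f ∸ 1) + #occupied occ (suc f) (r ∸ f)
#occupied-after-firstFree occ {suc f′} r _ f≤r f∉ below = begin
  #occupied occ 1 r
    ≡⟨ cong (#occupied occ 1) r≡ ⟨
  #occupied occ 1 (f′ + suc (r ∸ suc f′))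
    ≡⟨ #occupied-split occ 1 f′ _ ⟩
  #occupied occ 1 f′ + #occupied occ (suc f′) (suc (r ∸ suc f′))
    ≡⟨ cong₂ _+_ full (#occupied-no (r ∸ suc f′) f∉) ⟩
  f′ + #occupied occ (suc (suc f′)) (r ∸ suc f′)  ∎
  where
  open ≡-Reasoning
  r≡ : f′ + suc (r ∸ suc f′) ≡ r
  r≡ = trans (+-suc f′ _) (m+[n∸m]≡n f≤r)
  full : #occupied occ 1 f′ ≡ f′
  full = #occupied-full occ 1 f′ below

-- Parking one car

<⇒≤∸1 : ∀ {t a} → t < a → t ≤ a ∸ 1
<⇒≤∸1 {a = suc a} (s≤s t≤a) = t≤a

1+a+[n∸a]≡1+n : ∀ {a n} → a ≤ n → suc a + (n ∸ a) ≡ suc n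
1+a+[n∸a]≡1+n a≤n = cong suc (m+[n∸m]≡n a≤n)

checkBack-just : ∀ s r occ {x} → checkBack s r occ ≡ just x →
  x ∉ occ × 1 ≤ x × x ≤ s × s < x + r × (∀ t → x < t → t ≤ s → t ∈ occ)
checkBack-just (suc s) (suc r) occ eq with suc s ∈? occ
checkBack-just (suc s) (suc r) occ refl | no 1+s∉ =
  1+s∉ , s≤s z≤n , ≤-refl , m<m+n (suc s) (s≤s z≤n) , λ t x<t t≤x → ⊥-elim (<⇒≱ x<t t≤x)
... | yes 1+s∈ with checkBack-just s r occ eq
...   | x∉ , 1≤x , x≤s , s<x+r , between =
  x∉ , 1≤x , m≤n⇒m≤1+n x≤s , subst (suc s <_) (sym (+-suc _ r)) (s≤s s<x+r) , between′
  where
  between′ : ∀ t → _ < t → t ≤ suc s → t ∈ occ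
  between′ t x<t t≤1+s with m≤n⇒m<n∨m≡n t≤1+s
  ... | inj₁ t<1+s = between t x<t (≤-pred t<1+s)
  ... | inj₂ refl  = 1+s∈

checkBack-nothing : ∀ s r occ → checkBack s r occ ≡ nothing →
  ∀ t → 1 ≤ t → t ≤ s → s < t + r → t ∈ occ
checkBack-nothing zero    r       occ eq t 1≤t t≤0 _ = ⊥-elim (<⇒≱ 1≤t t≤0)
checkBack-nothing (suc s) zero    occ eq t _ t≤s s<t+0 =
  ⊥-elim (<⇒≱ (subst (suc s <_) (+-identityʳ t) s<t+0) t≤s)
checkBack-nothing (suc s) (suc r) occ eq t 1≤t t≤1+s 1+s<t+1+r with suc s ∈? occ
... | yes 1+s∈ with m≤n⇒m<n∨m≡n t≤1+s
...   | inj₂ refl    = 1+s∈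
...   | inj₁ t<1+s   =
  checkBack-nothing s r occ eq t 1≤t (≤-pred t<1+s) (≤-pred (subst (suc s <_) (+-suc t r) 1+s<t+1+r))

checkFwd-just : ∀ s r occ {x} → checkFwd s r occ ≡ just x →
  x ∉ occ × s ≤ x × x < s + r × (∀ t → s ≤ t → t < x → t ∈ occ)
checkFwd-just s (suc r) occ {x} eq with s ∈? occ
checkFwd-just s (suc r) occ refl | no s∉ =
  s∉ , ≤-refl , m<m+n s (s≤s z≤n) , λ t s≤t t<s → ⊥-elim (<⇒≱ t<s s≤t)
... | yes s∈ with checkFwd-just (suc s) r occ eq
...   | x∉ , s<x , x<1+s+r , between =
  x∉ , <⇒≤ s<x , subst (x <_) (sym (+-suc s r)) x<1+s+r , between′
  where
  between′ : ∀ t → s ≤ t → t < x → t ∈ occ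
  between′ t s≤t t<x with m≤n⇒m<n∨m≡n s≤t
  ... | inj₁ s<t = between t s<t t<x
  ... | inj₂ refl = s∈

checkFwd-nothing : ∀ s r occ → checkFwd s r occ ≡ nothing → ∀ t → s ≤ t → t < s + r → t ∈ occ
checkFwd-nothing s zero    occ eq t s≤t t<s+0 = ⊥-elim (<⇒≱ (subst (t <_) (+-identityʳ s) t<s+0) s≤t)
checkFwd-nothing s (suc r) occ eq t s≤t t<s+1+r with s ∈? occ
... | yes s∈ with m≤n⇒m<n∨m≡n s≤t
...   | inj₂ refl = s∈
...   | inj₁ s<t  = checkFwd-nothing (suc s) r occ eq t s<t (subst (t <_) (+-suc s r) t<s+1+r)

nothing≢just : ∀ {x : ℕ} → nothing ≢ just x
nothing≢just ()

module _ (n k : ℕ) where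

  data ParkView (occ : List ℕ) (a : ℕ) : Maybe ℕ → Set where
    atPreferred : a ∉ occ → ParkView occ a (just a)
    backward    : a ∈ occ → ∀ {x} → checkBack (a ∸ 1) k occ ≡ just x → ParkView occ a (just x)
    forward     : a ∈ occ → checkBack (a ∸ 1) k occ ≡ nothing →
                  ParkView occ a (checkFwd (suc a) (n ∸ a) occ)

  parkView : ∀ occ a → ParkView occ a (parkSpot n k occ a)
  parkView occ a with a ∈? occ
  ... | no  a∉ = atPreferred a∉
  ... | yes a∈ with checkBack (a ∸ 1) k occ in eq
  ...   | just _  = backward a∈ eq
  ...   | nothing = forward a∈ eq

  parkSpot-free : ∀ occ {a x} → 1 ≤ a → a ≤ n → parkSpot n k occ a ≡ just x →
                  x ∉ occ × 1 ≤ x × x ≤ n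
  parkSpot-free occ {a} {x} 1≤a a≤n eq with parkSpot n k occ a | parkView occ a | eq
  ... | _ | atPreferred a∉ | refl = a∉ , 1≤a , a≤n
  ... | _ | backward _ cb | refl =
    let x∉ , 1≤x , x≤a∸1 , _ = checkBack-just (a ∸ 1) k occ cb
    in  x∉ , 1≤x , ≤-trans x≤a∸1 (≤-trans (m∸n≤m a 1) a≤n)
  ... | _ | forward _ _ | cf =
    let x∉ , a<x , x<end , _ = checkFwd-just (suc a) (n ∸ a) occ cf
    in  x∉ , ≤-trans (s≤s z≤n) a<x , ≤-pred (subst (x <_) (1+a+[n∸a]≡1+n a≤n) x<end)

  parkSpot-≤-free : ∀ occ {a f} → f ∉ occ → f ≤ n → a ≤ f →
                    ∃[ x ] parkSpot n k occ a ≡ just x × x ≤ f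
  parkSpot-≤-free occ {a} {f} f∉ f≤n a≤f with parkSpot n k occ a | parkView occ a
  ... | _ | atPreferred _ = a , refl , a≤f
  ... | _ | backward _ {x} cb =
    let _ , _ , x≤a∸1 , _ = checkBack-just (a ∸ 1) k occ cb
    in  x , refl , ≤-trans x≤a∸1 (≤-trans (m∸n≤m a 1) a≤f)
  ... | _ | forward a∈ _ = forward-≤ (≤∧≢⇒< a≤f (λ { refl → f∉ a∈ }))
    where
    forward-≤ : a < f → ∃[ x ] checkFwd (suc a) (n ∸ a) occ ≡ just x × x ≤ f
    forward-≤ a<f with checkFwd (suc a) (n ∸ a) occ in cf
    ... | nothing = ⊥-elim (f∉ (checkFwd-nothing (suc a) (n ∸ a) occ cf f a<f
                                 (subst (f <_) (sym (1+a+[n∸a]≡1+n (<⇒≤ (<-≤-trans a<f f≤n)))) (s≤s f≤n))))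
    ... | just x  = let _ , _ , _ , between = checkFwd-just (suc a) (n ∸ a) occ cf
                    in  x , refl , ≮⇒≥ (λ f<x → f∉ (between f a<f f<x))

  parkSpot-preferred : ∀ occ {a} → a ∉ occ → parkSpot n k occ a ≡ just a
  parkSpot-preferred occ {a} a∉ with parkSpot n k occ a | parkView occ a
  ... | _ | atPreferred _ = refl
  ... | _ | backward a∈ _ = ⊥-elim (a∉ a∈)
  ... | _ | forward a∈ _  = ⊥-elim (a∉ a∈)

  parkSpot-above-free : ∀ occ {a f x} → f ∉ occ → f < a → parkSpot n k occ a ≡ just x → x ≢ f → f < x
  parkSpot-above-free occ {a} {f} f∉ f<a eq x≢f with parkSpot n k occ a | parkView occ a | eq
  ... | _ | atPreferred _ | refl = f<a
  ... | _ | backward _ cb | refl =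
    let _ , _ , _ , _ , between = checkBack-just (a ∸ 1) k occ cb
    in  ≰⇒> (λ x≤f → f∉ (between f (≤∧≢⇒< x≤f x≢f) (<⇒≤∸1 f<a)))
  ... | _ | forward _ _ | cf =
    let _ , a<x , _ = checkFwd-just (suc a) (n ∸ a) occ cf
    in  <-trans f<a a<x

  -- Once s is taken, so are the spots within k − 1 below it; hence a car from above s can never back up past s.
  Guarded : ℕ → List ℕ → Set
  Guarded s occ = s ∈ occ → ∀ t → 1 ≤ t → t ≤ s → s < t + k → t ∈ occ

  parkSpot-above-guarded : ∀ occ {s a x} → Guarded s occ → s < a → parkSpot n k occ a ≡ just x →
                           x ≢ s → s < x
  parkSpot-above-guarded occ {s} {a} guard s<a eq x≢s with parkSpot n k occ a | parkView occ a | eq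
  ... | _ | atPreferred _ | refl = s<a
  ... | _ | backward _ cb | refl =
    let x∉ , 1≤x , _ , a∸1<x+k , between = checkBack-just (a ∸ 1) k occ cb
    in  ≰⇒> (λ x≤s → x∉ (guard (between s (≤∧≢⇒< x≤s x≢s) (<⇒≤∸1 s<a)) _ 1≤x x≤s
                           (≤-<-trans (<⇒≤∸1 s<a) a∸1<x+k)))
  ... | _ | forward _ _ | cf =
    let _ , a<x , _ = checkFwd-just (suc a) (n ∸ a) occ cf
    in  <-trans s<a a<x

  parkSpot-forward-guards : ∀ occ {a s} → a < s → parkSpot n k occ a ≡ just s → Guarded s (s ∷ occ)
  parkSpot-forward-guards occ {a} {s} a<s eq _ t 1≤t t≤s s<t+k
    with parkSpot n k occ a | parkView occ a | eq
  ... | _ | atPreferred _ | refl = ⊥-elim (<-irrefl refl a<s)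
  ... | _ | backward _ cb | refl =
    let _ , _ , s≤a∸1 , _ = checkBack-just (a ∸ 1) k occ cb
    in  ⊥-elim (<⇒≱ a<s (≤-trans s≤a∸1 (m∸n≤m a 1)))
  ... | _ | forward a∈ cb | cf with m≤n⇒m<n∨m≡n t≤s
  ...   | inj₂ refl = here refl
  ...   | inj₁ t<s with <-cmp t a
  ...     | tri≈ _ refl _ = there a∈
  ...     | tri> _ _ a<t  = let _ , _ , _ , between = checkFwd-just (suc a) (n ∸ a) occ cf
                            in  there (between t a<t t<s)
  ...     | tri< t<a _ _  = there (checkBack-nothing (a ∸ 1) k occ cb t 1≤t (<⇒≤∸1 t<a)
                                     (≤-<-trans (≤-trans (m∸n≤m a 1) (<⇒≤ a<s)) s<t+k))

  Guarded-step : ∀ occ {s a x} → Guarded s occ → a ≢ s → (s < a → x ≢ s) →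
                 parkSpot n k occ a ≡ just x → Guarded s (x ∷ occ)
  Guarded-step occ guard a≢s _ eq (there s∈) t 1≤t t≤s s<t+k = there (guard s∈ t 1≤t t≤s s<t+k)
  Guarded-step occ {s} {a} guard a≢s not-from-above eq (here refl) =
    parkSpot-forward-guards occ a<s eq (here refl)
    where
    a<s : a < s
    a<s = ≤∧≢⇒< (≮⇒≥ (λ s<a → not-from-above s<a refl)) a≢s

  -- Parking all cars

  ValidPrefs : Vec ℕ m → Set
  ValidPrefs = All (λ a → 1 ≤ a × a ≤ n)

  spots : List ℕ → Vec ℕ m → Vec (Maybe ℕ) m
  spots occ as = proj₁ (runFrom n k occ as)

  final : List ℕ → Vec ℕ m → List ℕ
  final occ as = proj₂ (runFrom n k occ as)

  ⊆-final : ∀ occ (as : Vec ℕ m) → occ ⊆ final occ as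
  ⊆-final occ []       t∈ = t∈
  ⊆-final occ (a ∷ as) t∈ with parkSpot n k occ a
  ... | nothing = ⊆-final occ as t∈
  ... | just x  = ⊆-final (x ∷ occ) as (there t∈)

  parked∈final : ∀ occ (as : Vec ℕ m) i {x} → lookup (spots occ as) i ≡ just x → x ∈ final occ as
  parked∈final occ (a ∷ as) Fin.zero eq with parkSpot n k occ a | eq
  ... | just x | refl = ⊆-final (x ∷ occ) as (here refl)
  parked∈final occ (a ∷ as) (Fin.suc i) eq with parkSpot n k occ a
  ... | just x  = parked∈final (x ∷ occ) as i eq
  ... | nothing = parked∈final occ as i eq

  #failed : Vec (Maybe ℕ) m → ℕ
  #failed = countᵇ is-nothing

  #failed-pos : ∀ (v : Vec (Maybe ℕ) m) i → lookup v i ≡ nothing → 1 ≤ #failed v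
  #failed-pos (nothing ∷ v) _           _  = s≤s z≤n
  #failed-pos (just _ ∷ v)  (Fin.suc i) eq = #failed-pos v i eq

  0∉final : ∀ occ (as : Vec ℕ m) → ValidPrefs as → 0 ∉ occ → 0 ∉ final occ as
  0∉final occ []       []                    0∉ = 0∉
  0∉final occ (a ∷ as) ((1≤a , a≤n) ∷ valid) 0∉ with parkSpot n k occ a in eq
  ... | nothing = 0∉final occ as valid 0∉
  ... | just x  =
    0∉final (x ∷ occ) as valid (∉-∷ (<⇒≢ (proj₁ (proj₂ (parkSpot-free occ 1≤a a≤n eq)))) 0∉)

  #occupiedAbove+#failed : ∀ occ (as : Vec ℕ m) {f} → ValidPrefs as → f ≤ n → f ∉ final occ as →
    #occupied (final occ as) (suc f) (n ∸ f) + #failed (spots occ as)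
      ≡ #occupied occ (suc f) (n ∸ f) + tailMult as (suc f)
  #occupiedAbove+#failed occ [] [] f≤n f∉ = refl
  #occupiedAbove+#failed occ (a ∷ as) {f} ((1≤a , a≤n) ∷ valid) f≤n f∉ with parkSpot n k occ a in eq
  ... | nothing = begin
    #occupied (final occ as) (suc f) (n ∸ f) + suc (#failed (spots occ as))
      ≡⟨ +-suc _ _ ⟩
    suc (#occupied (final occ as) (suc f) (n ∸ f) + #failed (spots occ as))
      ≡⟨ cong suc (#occupiedAbove+#failed occ as valid f≤n f∉) ⟩
    suc (#occupied occ (suc f) (n ∸ f) + tailMult as (suc f))
      ≡⟨ +-suc _ _ ⟨
    #occupied occ (suc f) (n ∸ f) + suc (tailMult as (suc f))
      ≡⟨ cong (_ +_) (count-yes (suc f ≤?_) as f<a) ⟨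
    #occupied occ (suc f) (n ∸ f) + tailMult (a ∷ as) (suc f)  ∎
    where
    open ≡-Reasoning
    f<a : f < a
    f<a = ≰⇒> λ a≤f → let _ , parks , _ = parkSpot-≤-free occ (f∉ ∘ ⊆-final occ as) f≤n a≤f
                      in  nothing≢just (trans (sym eq) parks)
  ... | just x with a ≤? f
  ...   | yes a≤f = begin
    #occupied (final (x ∷ occ) as) (suc f) (n ∸ f) + #failed (spots (x ∷ occ) as)
      ≡⟨ #occupiedAbove+#failed (x ∷ occ) as valid f≤n f∉ ⟩
    #occupied (x ∷ occ) (suc f) (n ∸ f) + tailMult as (suc f)
      ≡⟨ cong₂ _+_ (#occupied-∷-below occ (suc f) (n ∸ f) (s≤s x≤f))
                   (sym (count-no (suc f ≤?_) as (≤⇒≯ a≤f))) ⟩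
    #occupied occ (suc f) (n ∸ f) + tailMult (a ∷ as) (suc f)  ∎
    where
    open ≡-Reasoning
    x≤f : x ≤ f
    x≤f = let _ , parks , x′≤f = parkSpot-≤-free occ (f∉ ∘ ⊆-final (x ∷ occ) as ∘ there) f≤n a≤f
          in  subst (_≤ f) (just-injective (trans (sym parks) eq)) x′≤f
  ...   | no a≰f = begin
    #occupied (final (x ∷ occ) as) (suc f) (n ∸ f) + #failed (spots (x ∷ occ) as)
      ≡⟨ #occupiedAbove+#failed (x ∷ occ) as valid f≤n f∉ ⟩
    #occupied (x ∷ occ) (suc f) (n ∸ f) + tailMult as (suc f)
      ≡⟨ cong (_+ _) (#occupied-∷-inside occ (suc f) (n ∸ f) x∉ f<x
                       (subst (x <_) (sym (1+a+[n∸a]≡1+n f≤n)) (s≤s x≤n))) ⟩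
    suc (#occupied occ (suc f) (n ∸ f) + tailMult as (suc f))
      ≡⟨ +-suc _ _ ⟨
    #occupied occ (suc f) (n ∸ f) + suc (tailMult as (suc f))
      ≡⟨ cong (_ +_) (count-yes (suc f ≤?_) as f<a) ⟨
    #occupied occ (suc f) (n ∸ f) + tailMult (a ∷ as) (suc f)  ∎
    where
    open ≡-Reasoning
    f<a : f < a
    f<a = ≰⇒> a≰f
    x∉ : x ∉ occ
    x∉ = proj₁ (parkSpot-free occ 1≤a a≤n eq)
    x≤n : x ≤ n
    x≤n = proj₂ (proj₂ (parkSpot-free occ 1≤a a≤n eq))
    f<x : f < x
    f<x = parkSpot-above-free occ (f∉ ∘ ⊆-final (x ∷ occ) as ∘ there) f<a eq
            (λ { refl → f∉ (⊆-final (x ∷ occ) as (here refl)) })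

  free⇒unpreferred : ∀ occ (as : Vec ℕ m) {f} → f ∉ final occ as → count (_≟ f) as ≡ 0
  free⇒unpreferred occ []       f∉ = refl
  free⇒unpreferred occ (a ∷ as) {f} f∉ with f ≟ a
  ... | no f≢a  = trans (count-no (_≟ f) as (f≢a ∘ sym)) (free⇒unpreferred _ as f∉)
  ... | yes refl = ⊥-elim (f∉ (subst (λ r → f ∈ final (addSpot r occ) as)
                             (sym (parkSpot-preferred occ (f∉ ∘ ⊆-final occ (f ∷ as))))
                             (⊆-final (f ∷ occ) as (here refl))))

  #occupiedAbove-step : ∀ occ (as : Vec ℕ m) {s a x} → s ≤ n → 1 ≤ a → a ≤ n → Guarded s occ →
    parkSpot n k occ a ≡ just x → (s < a → x ≢ s) →
    #occupied occ (suc s) (n ∸ s) + tailMult (a ∷ as) (suc s)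
      ≤ #occupied (x ∷ occ) (suc s) (n ∸ s) + tailMult as (suc s)
  #occupiedAbove-step occ as {s} {a} {x} s≤n 1≤a a≤n guard eq x≢s with a ≤? s
  ... | yes a≤s = begin
    #occupied occ (suc s) (n ∸ s) + tailMult (a ∷ as) (suc s)
      ≡⟨ cong (_ +_) (count-no (suc s ≤?_) as (≤⇒≯ a≤s)) ⟩
    #occupied occ (suc s) (n ∸ s) + tailMult as (suc s)
      ≤⟨ +-monoˡ-≤ _ (#occupied-mono there (suc s) (n ∸ s)) ⟩
    #occupied (x ∷ occ) (suc s) (n ∸ s) + tailMult as (suc s)  ∎
    where open ≤-Reasoning
  ... | no a≰s = ≤-reflexive (begin
    #occupied occ (suc s) (n ∸ s) + tailMult (a ∷ as) (suc s)
      ≡⟨ cong (_ +_) (count-yes (suc s ≤?_) as s<a) ⟩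
    #occupied occ (suc s) (n ∸ s) + suc (tailMult as (suc s))
      ≡⟨ +-suc _ _ ⟩
    suc (#occupied occ (suc s) (n ∸ s)) + tailMult as (suc s)
      ≡⟨ cong (_+ _) (#occupied-∷-inside occ (suc s) (n ∸ s) x∉ s<x
                       (subst (x <_) (sym (1+a+[n∸a]≡1+n s≤n)) (s≤s x≤n))) ⟨
    #occupied (x ∷ occ) (suc s) (n ∸ s) + tailMult as (suc s)  ∎)
    where
    open ≡-Reasoning
    s<a : s < a
    s<a = ≰⇒> a≰s
    x∉ : x ∉ occ
    x∉ = proj₁ (parkSpot-free occ 1≤a a≤n eq)
    x≤n : x ≤ n
    x≤n = proj₂ (proj₂ (parkSpot-free occ 1≤a a≤n eq))
    s<x : s < x
    s<x = parkSpot-above-guarded occ guard s<a eq (x≢s s<a)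

  tailMult≤#occupiedAbove : ∀ occ (as : Vec ℕ m) {s} → s ≤ n → ValidPrefs as → Guarded s occ →
    (∀ i → Is-just (lookup (spots occ as) i)) → All (_≢ s) as →
    (∀ i → s < lookup as i → lookup (spots occ as) i ≢ just s) →
    #occupied occ (suc s) (n ∸ s) + tailMult as (suc s) ≤ #occupied (final occ as) (suc s) (n ∸ s)
  tailMult≤#occupiedAbove occ [] _ [] _ _ [] _ = ≤-reflexive (+-identityʳ _)
  tailMult≤#occupiedAbove occ (a ∷ as) s≤n ((1≤a , a≤n) ∷ valid) guard parks (a≢s ∷ ≢s) notAtS
    with parkSpot n k occ a in eq
  ... | nothing with () ← parks Fin.zero
  ... | just x = ≤-trans (#occupiedAbove-step occ as s≤n 1≤a a≤n guard eq x≢s)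
                   (tailMult≤#occupiedAbove (x ∷ occ) as s≤n valid (Guarded-step occ guard a≢s x≢s eq)
                      (parks ∘ Fin.suc) ≢s (notAtS ∘ Fin.suc))
    where
    x≢s : _ < a → x ≢ _
    x≢s s<a x≡s = notAtS Fin.zero s<a (cong just x≡s)

  #occupied+#failed≡n : (α : Vec ℕ n) → InPP n α → #occupied (final [] α) 1 n + #failed (spots [] α) ≡ n
  #occupied+#failed≡n α pp =
    trans (#occupiedAbove+#failed [] α pp z≤n (0∉final [] α pp λ ()))
          (cong₂ _+_ (#occupied-[] 1 n) (All⇒count≡n (1 ≤?_) (All.map proj₁ pp)))

  failure⇒#occupied<n : (α : Vec ℕ n) → InPP n α → ∀ i → ψ n k α i ≡ nothing →
                        #occupied (final [] α) 1 n < n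
  failure⇒#occupied<n α pp i failed =
    subst (O <_) (#occupied+#failed≡n α pp) (subst (_≤ O + N) (+-comm O 1) (+-monoʳ-≤ O 1≤N))
    where
    O N : ℕ
    O = #occupied (final [] α) 1 n
    N = #failed (spots [] α)
    1≤N : 1 ≤ N
    1≤N = #failed-pos (spots [] α) i failed

  failure⇒emptyLeftEnd : (α : Vec ℕ n) → InPP n α → ∀ i → ψ n k α i ≡ nothing →
                            ∃[ f ] f ∉ finalOccupied n k α × InU α (suc f) × ¬ InU α f
  failure⇒emptyLeftEnd α pp i failed with firstFree (final [] α) 1 n (failure⇒#occupied<n α pp i failed)
  ... | f@(suc f′) , 1≤f , f<1+n , f∉F , below =
    f , f∉F , from (leftEnd⇔ pp f 1≤f) (T≡ , free⇒unpreferred [] α f∉F)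
    where
    F : List ℕ
    F = final [] α
    N A : ℕ
    N = #failed (spots [] α)
    A = #occupied F (suc f) (n ∸ f)
    f≤n : f ≤ n
    f≤n = ≤-pred f<1+n
    A+N≡T : A + N ≡ tailMult α (suc f)
    A+N≡T = trans (#occupiedAbove+#failed [] α pp f≤n f∉F)
                  (cong (_+ tailMult α (suc f)) (#occupied-[] (suc f) (n ∸ f)))
    f′+T≡n : f′ + tailMult α (suc f) ≡ n
    f′+T≡n = begin
      f′ + tailMult α (suc f)  ≡⟨ cong (f′ +_) A+N≡T ⟨
      f′ + (A + N)             ≡⟨ +-assoc f′ A N ⟨
      f′ + A + N               ≡⟨ cong (_+ N) (#occupied-after-firstFree F n 1≤f f≤n f∉F below) ⟨
      #occupied F 1 n + N      ≡⟨ #occupied+#failed≡n α pp ⟩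
      n                        ∎
      where open ≡-Reasoning
    T≡ : tailMult α (suc f) ≡ suc (n ∸ f)
    T≡ = trans (sym (m+n∸m≡n f′ _)) (trans (cong (_∸ f′) f′+T≡n) (+-∸-assoc 1 f≤n))

  PF⇒carParksAtLeftEnd : (α : Vec ℕ n) → InPP n α → PF n k α → ∀ p q → MaximalInterval (InU α) p q →
                         ∃[ i ] (p ≤ lookup α i × ψ n k α i ≡ just (p ∸ 1))
  PF⇒carParksAtLeftEnd α pp pf zero       q maximal with () ← MaximalInterval⇒lower maximal
  PF⇒carParksAtLeftEnd α pp pf (suc zero) q maximal = ⊥-elim (¬InU-1 pp (MaximalInterval⇒lower maximal))
  PF⇒carParksAtLeftEnd α pp pf (suc s@(suc _)) q maximal
    with any? (λ i → (suc s ≤? lookup α i) ×-dec (≡-dec-Maybe _≟_ (ψ n k α i) (just s)))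
  ... | yes parksAtS = parksAtS
  ... | no ¬parksAtS = ⊥-elim (<⇒≱ n∸s<T (begin
    tailMult α (suc s)
      ≡⟨ cong (_+ tailMult α (suc s)) (#occupied-[] (suc s) (n ∸ s)) ⟨
    #occupied [] (suc s) (n ∸ s) + tailMult α (suc s)
      ≤⟨ tailMult≤#occupiedAbove [] α (<⇒≤ s<n) pp (λ ()) pf unpreferred
           (λ i s<aᵢ ψᵢ≡s → ¬parksAtS (i , s<aᵢ , ψᵢ≡s)) ⟩
    #occupied (final [] α) (suc s) (n ∸ s)
      ≤⟨ count≤n (_∈? final [] α) (iterate suc (suc s) (n ∸ s)) ⟩
    n ∸ s  ∎))
    where
    open ≤-Reasoning
    Us : InU α (suc s)
    Us = MaximalInterval⇒lower maximal
    s<n : s < n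
    s<n = proj₁ (to (InU-suc⇔ pp s) Us)
    n∸s<T : n ∸ s < tailMult α (suc s)
    n∸s<T = proj₂ (to (InU-suc⇔ pp s) Us)
    unpreferred : All (_≢ s) α
    unpreferred = count≡0⇒All¬ (_≟ s) α
                    (proj₂ (to (leftEnd⇔ pp s (s≤s z≤n)) (Us , MaximalInterval⇒¬pred maximal)))

  PF⇒leftEndsOccupied : (α : Vec ℕ n) → InPP n α → PF n k α →
                        ∀ p q → MaximalInterval (InU α) p q → (p ∸ 1) ∈ finalOccupied n k α
  PF⇒leftEndsOccupied α pp pf p q maximal =
    let i , _ , ψᵢ≡ = PF⇒carParksAtLeftEnd α pp pf p q maximal
    in  parked∈final [] α i ψᵢ≡

  leftEndsOccupied⇒PF : (α : Vec ℕ n) → InPP n α →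
                        (∀ p q → MaximalInterval (InU α) p q → (p ∸ 1) ∈ finalOccupied n k α) → PF n k α
  leftEndsOccupied⇒PF α pp occupied i with ψ n k α i in failed
  ... | just _  = just tt
  ... | nothing =
    let f , f∉ , U1+f , ¬Uf = failure⇒emptyLeftEnd α pp i failed
        q , maximal = maximalInterval-after (InU? α) (λ j Uj → proj₂ (proj₁ Uj)) ¬Uf U1+f
    in  ⊥-elim (f∉ (occupied (suc f) q maximal))

mainTheorem5 : (n k : ℕ) → (α : Vec ℕ n) → InPP n α → 1 ≤ k →
    (PF n k α ⇔ (∀ p q → MaximalInterval (InU α) p q → (p ∸ 1) ∈ finalOccupied n k α))
    × (PF n k α → ∀ p q → MaximalInterval (InU α) p q →
         ∃[ i ] (p ≤ lookup α i × ψ n k α i ≡ just (p ∸ 1)))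
mainTheorem5 n k α pp _ =
  mk⇔ (PF⇒leftEndsOccupied n k α pp) (leftEndsOccupied⇒PF n k α pp) , PF⇒carParksAtLeftEnd n k α pp
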